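{- For all integers $d\geq r\geq 1$, \[m(Q_d,r)\leq m(Q_{d-r},r)+(r-1)\,m(Q_{d-r},r-1)+\sum_{j=1}^{\lceil r/2\rceil-1}\binom{r}{2j+1}m(Q_{d-r},r-2j).\]
   Context: The $r$-neighbour bootstrap process on a graph $G$ starts from $A_0\subseteq V(G)$ and sets $A_j:=A_{j-1}\cup\{v:|N_G(v)\cap A_{j-1}|\geq r\}$; $A_0$ percolates if $\bigcup_jA_j=V(G)$; $m(G,r)$ is the minimum size of a percolating set. $Q_n$ is the hypercube on $\{0,1\}^n$ (adjacent iff differing in exactly one coordinate); $Q_0$ is a single vertex. -}

module Defs where

open import Data.Nat using (ℕ; zero; suc; _+_; _*_; _∸_; _≤_; _≤ᵇ_)
open import Data.Bool using (Bool; true; false; _∨_; not; if_then_else_)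
open import Data.Fin using (Fin)
open import Data.Vec using (Vec; []; _∷_; updateAt; lookup)
open import Data.List using (List; []; _∷_; map; _++_; filter; length)
open import Data.Nat.ListAction using (sum)
open import Data.List.Base using (allFin)
open import Data.Product using (Σ; ∃; _×_)
open import Data.Bool using (T; T?)
open import Relation.Nullary.Decidable using (Dec)
open import Relation.Binary.PropositionalEquality using (_≡_)
open import Function using (_∘_)

-- Vertices of the hypercube Q_n: binary vectors of length n.
Vertex : ℕ → Set
Vertex n = Vec Bool n

VSet : ℕ → Set
VSet n = Vertex n → Bool

flip : ∀ {n} → Fin n → Vertex n → Vertex n
flip i v = updateAt v i not

allVertices : (n : ℕ) → List (Vertex n)
allVertices zero = [] ∷ []
allVertices (suc n) = map (true ∷_) (allVertices n) ++ map (false ∷_) (allVertices n)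

size : ∀ {n} → VSet n → ℕ
size {n} A = length (filter (λ v → T? (A v)) (allVertices n))

nbrCount : ∀ {n} → VSet n → Vertex n → ℕ
nbrCount {n} A v = sum (map (λ i → if A (flip i v) then 1 else 0) (allFin n))

step : ∀ {n} → ℕ → VSet n → VSet n
step r A v = A v ∨ (r ≤ᵇ nbrCount A v)

infected : ∀ {n} → ℕ → VSet n → ℕ → VSet n
infected r A zero = A
infected r A (suc j) = step r (infected r A j)

Percolates : (n r : ℕ) → VSet n → Set
Percolates n r A = (v : Vertex n) → ∃ λ j → infected r A j v ≡ true

IsM : (n r k : ℕ) → Set
IsM n r k = (Σ (VSet n) λ A → Percolates n r A × size A ≡ k)
          × ((A : VSet n) → Percolates n r A → k ≤ size A)

sumFrom1 : ℕ → (ℕ → ℕ) → ℕ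
sumFrom1 zero f = 0
sumFrom1 (suc K) f = sumFrom1 K f + f (suc K)

module Submission where

-- Write r = 1 + n, k = d - r and Q_d = Q_{1+n} × Q_k, a vertex being (b ∷ u) ++ y with
-- u ∈ Q_n and y ∈ Q_k.  Suppose that for every weight ℓ we are given a set seed(ℓ) ⊆ Q_k
-- percolating under some threshold t(ℓ) with r ≤ ℓ + t(ℓ).  Put seed(weight u) into the fibre
-- over b ∷ u when b ∷ u has even parity, and nothing into the odd fibres.  By induction on
-- weight u both fibres over u are eventually infected: the even fibre replays t(ℓ)-bootstrap
-- on its seeds, helped by the ℓ odd fibres over the lower neighbours of u; the odd fibre over
-- u is infected at the seeds of the even fibres over the upper neighbours of u (all r outside
-- neighbours are infected there) and then replays t(ℓ+1)-bootstrap, helped by ℓ + 1 fibres.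
-- The set has Σ_ℓ C(n,ℓ) |seed(ℓ)| elements.  Taking seed 0, seed 1 optimal for thresholds r,
-- r - 1 and seed(2j), seed(2j+1) optimal for r - 2j (empty, threshold 0, once 2j ≥ r), the
-- identity C(n,2j) + C(n,2j+1) = C(r,2j+1) turns this count into the stated bound.

open import Defs
open import Data.Nat using (ℕ; zero; suc; _+_; _*_; _∸_; _≤_; _<_; _≤′_; ≤′-refl; ≤′-step; z≤n; s≤s; _⊔_; ⌊_/2⌋; ⌈_/2⌉; _≤?_)
open import Data.Nat.Properties
open import Data.Nat.Combinatorics using (_C_; k>n⇒nCk≡0; nC1≡n; nCk+nC[k+1]≡[n+1]C[k+1])
open import Data.Nat.ListAction using (sum)
open import Data.Bool using (Bool; true; false; not; _∨_; _xor_; if_then_else_; T?)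
open import Data.Bool.Properties using (∨-zeroʳ; not-involutive; xor-same; not-distribˡ-xor; not-distribʳ-xor; T-≡; ¬-not) renaming (_≟_ to _≟ᵇ_)
open import Data.Fin using (Fin; zero; suc; _↑ˡ_; _↑ʳ_)
open import Data.Vec using (Vec; []; _∷_; _++_; lookup; take; drop)
open import Data.Vec.Properties using (take++drop≡id; ++-injectiveˡ; ++-injectiveʳ)
open import Data.List using (List; tabulate; filter; length) renaming (map to mapL; _++_ to _++L_; [] to []L; _∷_ to _∷L_)
open import Data.List.Properties using (map-tabulate; filter-++; length-++)
open import Data.Product using (∃; _×_; _,_; proj₁; proj₂)
open import Relation.Binary.PropositionalEquality using (_≡_; refl; sym; trans; cong; cong₂; subst; module ≡-Reasoning)
open import Relation.Nullary using (Dec; yes; no; contradiction)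
open import Function.Bundles using (Equivalence)
open import Algebra.Properties.CommutativeSemigroup +-commutativeSemigroup using (interchange; x∙yz≈y∙xz)

ind : Bool → ℕ
ind b = if b then 1 else 0

count : (n : ℕ) → (Fin n → Bool) → ℕ
count zero    P = 0
count (suc n) P = ind (P zero) + count n (λ i → P (suc i))

nbrCount≡count : ∀ {n} (A : VSet n) (v : Vertex n) → nbrCount A v ≡ count n (λ i → A (flip i v))
nbrCount≡count {n} A v =
  trans (cong sum (map-tabulate (λ i → i) (λ i → ind (A (flip i v))))) (sum-ind n (λ i → A (flip i v)))
  where
  sum-ind : ∀ n (P : Fin n → Bool) → sum (tabulate (λ i → ind (P i))) ≡ count n P
  sum-ind zero    P = refl
  sum-ind (suc n) P = cong (ind (P zero) +_) (sum-ind n (λ i → P (suc i)))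

count-mono : ∀ n {P Q : Fin n → Bool} → (∀ i → P i ≡ true → Q i ≡ true) → count n P ≤ count n Q
count-mono zero    h = z≤n
count-mono (suc n) h = +-mono-≤ (ind-mono (h zero)) (count-mono n (λ i → h (suc i)))
  where
  ind-mono : ∀ {b c} → (b ≡ true → c ≡ true) → ind b ≤ ind c
  ind-mono {false} _ = z≤n
  ind-mono {true}  h rewrite h refl = ≤-refl

count-true : ∀ n → count n (λ _ → true) ≡ n
count-true zero    = refl
count-true (suc n) = cong suc (count-true n)

count-false : ∀ n → count n (λ _ → false) ≡ 0
count-false zero    = refl
count-false (suc n) = count-false n

count-++ : ∀ m k (P : Fin (m + k) → Bool) →
           count (m + k) P ≡ count m (λ i → P (i ↑ˡ k)) + count k (λ j → P (m ↑ʳ j))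
count-++ zero    k P = refl
count-++ (suc m) k P = trans (cong (ind (P zero) +_) (count-++ m k (λ i → P (suc i))))
                             (sym (+-assoc (ind (P zero)) _ _))

flip-↑ˡ : ∀ {m k} (i : Fin m) (x : Vertex m) (y : Vertex k) → flip (i ↑ˡ k) (x ++ y) ≡ flip i x ++ y
flip-↑ˡ zero    (a ∷ x) y = refl
flip-↑ˡ (suc i) (a ∷ x) y = cong (a ∷_) (flip-↑ˡ i x y)

flip-↑ʳ : ∀ {m k} (x : Vertex m) (j : Fin k) (y : Vertex k) → flip (m ↑ʳ j) (x ++ y) ≡ x ++ flip j y
flip-↑ʳ []      j y = refl
flip-↑ʳ (a ∷ x) j y = cong (a ∷_) (flip-↑ʳ x j y)

nbrCount-++ : ∀ {m k} (A : VSet (m + k)) (x : Vertex m) (y : Vertex k)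
              (Px : Fin m → Bool) (Py : Fin k → Bool) →
              (∀ i → Px i ≡ true → A (flip i x ++ y) ≡ true) →
              (∀ j → Py j ≡ true → A (x ++ flip j y) ≡ true) →
              count m Px + count k Py ≤ nbrCount A (x ++ y)
nbrCount-++ {m} {k} A x y Px Py hx hy = begin
  count m Px + count k Py
    ≤⟨ +-mono-≤ (count-mono m (λ i p → trans (cong A (flip-↑ˡ i x y)) (hx i p)))
                (count-mono k (λ j p → trans (cong A (flip-↑ʳ x j y)) (hy j p))) ⟩
  count m (λ i → A (flip (i ↑ˡ k) (x ++ y))) + count k (λ j → A (flip (m ↑ʳ j) (x ++ y)))
    ≡⟨ sym (count-++ m k (λ i → A (flip i (x ++ y)))) ⟩
  count (m + k) (λ i → A (flip i (x ++ y)))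
    ≡⟨ sym (nbrCount≡count A (x ++ y)) ⟩
  nbrCount A (x ++ y) ∎
  where open ≤-Reasoning

commonTime : ∀ n (Q : Fin n → ℕ → Set) → (∀ i {j j'} → j ≤ j' → Q i j → Q i j') →
             (∀ i → ∃ (Q i)) → ∃ λ J → ∀ i → Q i J
commonTime zero    Q mono h = 0 , λ ()
commonTime (suc n) Q mono h with h zero | commonTime n (λ i → Q (suc i)) (λ i → mono (suc i)) (λ i → h (suc i))
... | j₀ , q₀ | J , qs = j₀ ⊔ J , holds
  where
  holds : ∀ i → Q i (j₀ ⊔ J)
  holds zero    = mono zero (m≤m⊔n j₀ J) q₀
  holds (suc i) = mono (suc i) (m≤n⊔m j₀ J) (qs i)

module Bootstrap (r : ℕ) {n : ℕ} (A : VSet n) where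

  Eventually : Vertex n → Set
  Eventually v = ∃ λ j → infected r A j v ≡ true

  infected-mono : ∀ {j j'} v → j ≤ j' → infected r A j v ≡ true → infected r A j' v ≡ true
  infected-mono v le = go (≤⇒≤′ le)
    where
    go : ∀ {j j'} → j ≤′ j' → infected r A j v ≡ true → infected r A j' v ≡ true
    go ≤′-refl       p = p
    go (≤′-step le′) p rewrite go le′ p = refl

  infected-by-count : ∀ j v → r ≤ nbrCount (infected r A j) v → infected r A (suc j) v ≡ true
  infected-by-count j v le =
    trans (cong (infected r A j v ∨_) (Equivalence.to T-≡ (≤⇒≤ᵇ le))) (∨-zeroʳ _)

  eventuallyAll : ∀ {m} (w : Fin m → Vertex n) (P : Fin m → Bool) →
                  (∀ i → P i ≡ true → Eventually (w i)) →
                  ∃ λ J → ∀ i → P i ≡ true → infected r A J (w i) ≡ true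
  eventuallyAll {m} w P h =
    commonTime m (λ i J → P i ≡ true → infected r A J (w i) ≡ true)
                 (λ i le q p → infected-mono (w i) le (q p)) selected
    where
    selected : ∀ i → ∃ λ J → P i ≡ true → infected r A J (w i) ≡ true
    selected i with P i in eq
    ... | true  = proj₁ (h i eq) , λ _ → proj₂ (h i eq)
    ... | false = 0 , λ ()

-- Bootstrap in Q_{m+k} = Q_m × Q_k, where the fibre over x ∈ Q_m is {x ++ y | y ∈ Q_k}.
module Fibres (r : ℕ) {m k : ℕ} (A : VSet (m + k)) where
  open Bootstrap r A

  byNeighbours : (x : Vertex m) (y : Vertex k) (Px : Fin m → Bool) (Py : Fin k → Bool) →
                 (∀ i → Px i ≡ true → Eventually (flip i x ++ y)) →
                 (∀ j → Py j ≡ true → Eventually (x ++ flip j y)) →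
                 r ≤ count m Px + count k Py → Eventually (x ++ y)
  byNeighbours x y Px Py hx hy le
    with eventuallyAll (λ i → flip i x ++ y) Px hx | eventuallyAll (λ j → x ++ flip j y) Py hy
  ... | J₁ , q₁ | J₂ , q₂ = suc (J₁ ⊔ J₂) , infected-by-count (J₁ ⊔ J₂) (x ++ y) (≤-trans le enough)
    where
    enough : count m Px + count k Py ≤ nbrCount (infected r A (J₁ ⊔ J₂)) (x ++ y)
    enough = nbrCount-++ (infected r A (J₁ ⊔ J₂)) x y Px Py
               (λ i p → infected-mono _ (m≤m⊔n J₁ J₂) (q₁ i p))
               (λ j p → infected-mono _ (m≤n⊔m J₁ J₂) (q₂ j p))

  -- Then the fibre over x is eventually fully
  -- infected: it replays t-neighbour bootstrap from B, each vertex having count m P extra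
  -- infected neighbours outside the fibre.
  fibreInfected : (x : Vertex m) (t : ℕ) (B : VSet k) → Percolates k t B →
                  (∀ y → B y ≡ true → Eventually (x ++ y)) →
                  (P : Fin m → Bool) → (∀ i → P i ≡ true → ∀ y → Eventually (flip i x ++ y)) →
                  r ≤ count m P + t → ∀ y → Eventually (x ++ y)
  fibreInfected x t B perc seeds P hx le y = replay (proj₁ (perc y)) y (proj₂ (perc y))
    where
    replay : ∀ j y → infected t B j y ≡ true → Eventually (x ++ y)
    replay zero    y p = seeds y p
    replay (suc j) y p with infected t B j y in q
    ... | true  = replay j y q
    ... | false = byNeighbours x y P (λ i → infected t B j (flip i y)) (λ i p → hx i p y)
                    (λ i → replay j (flip i y)) (≤-trans le (+-monoʳ-≤ (count m P) inner))
      where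
      inner : t ≤ count k (λ i → infected t B j (flip i y))
      inner = subst (t ≤_) (nbrCount≡count (infected t B j) y) (≤ᵇ⇒≤ t _ (Equivalence.from T-≡ p))

parity : ∀ {n} → Vertex n → Bool
parity []      = false
parity (b ∷ u) = b xor parity u

weight : ∀ {n} → Vertex n → ℕ
weight []      = 0
weight (b ∷ u) = ind b + weight u

parity-flip : ∀ {n} (i : Fin n) (u : Vertex n) → parity (flip i u) ≡ not (parity u)
parity-flip zero    (b ∷ u) = sym (not-distribˡ-xor b (parity u))
parity-flip (suc i) (b ∷ u) = trans (cong (b xor_) (parity-flip i u)) (sym (not-distribʳ-xor b (parity u)))

weight-flip-1 : ∀ {n} (i : Fin n) (u : Vertex n) → lookup u i ≡ true → suc (weight (flip i u)) ≡ weight u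
weight-flip-1 zero    (true ∷ u) p = refl
weight-flip-1 (suc i) (b ∷ u)    p = trans (sym (+-suc (ind b) _)) (cong (ind b +_) (weight-flip-1 i u p))

weight-flip-0 : ∀ {n} (i : Fin n) (u : Vertex n) → lookup u i ≡ false → weight (flip i u) ≡ suc (weight u)
weight-flip-0 zero    (false ∷ u) p = refl
weight-flip-0 (suc i) (b ∷ u)     p = trans (cong (ind b +_) (weight-flip-0 i u p)) (+-suc (ind b) _)

weight≡count : ∀ {n} (u : Vertex n) → weight u ≡ count n (lookup u)
weight≡count []      = refl
weight≡count (b ∷ u) = cong (ind b +_) (weight≡count u)

sumCube : (n : ℕ) → (Vertex n → ℕ) → ℕ
sumCube zero    f = f []
sumCube (suc n) f = sumCube n (λ v → f (true ∷ v)) + sumCube n (λ v → f (false ∷ v))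

sumCube-cong : ∀ n {f g : Vertex n → ℕ} → (∀ v → f v ≡ g v) → sumCube n f ≡ sumCube n g
sumCube-cong zero    h = h []
sumCube-cong (suc n) h = cong₂ _+_ (sumCube-cong n (λ v → h _)) (sumCube-cong n (λ v → h _))

sumCube-+ : ∀ n (f g : Vertex n → ℕ) → sumCube n f + sumCube n g ≡ sumCube n (λ v → f v + g v)
sumCube-+ zero    f g = refl
sumCube-+ (suc n) f g = trans (interchange (sumCube n (λ v → f (true ∷ v))) (sumCube n (λ v → f (false ∷ v)))
                                             (sumCube n (λ v → g (true ∷ v))) (sumCube n (λ v → g (false ∷ v))))
  (cong₂ _+_ (sumCube-+ n (λ v → f (true ∷ v)) (λ v → g (true ∷ v)))
             (sumCube-+ n (λ v → f (false ∷ v)) (λ v → g (false ∷ v))))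

sumCube-0 : ∀ n → sumCube n (λ _ → 0) ≡ 0
sumCube-0 zero    = refl
sumCube-0 (suc n) = cong₂ _+_ (sumCube-0 n) (sumCube-0 n)

sumCube-++ : ∀ m k (f : Vertex (m + k) → ℕ) → sumCube (m + k) f ≡ sumCube m (λ x → sumCube k (λ y → f (x ++ y)))
sumCube-++ zero    k f = refl
sumCube-++ (suc m) k f = cong₂ _+_ (sumCube-++ m k _) (sumCube-++ m k _)

size≡sumCube : ∀ n (A : VSet n) → size A ≡ sumCube n (λ v → ind (A v))
size≡sumCube zero A with A []
... | true  = refl
... | false = refl
size≡sumCube (suc n) A = begin
  length (filter A? (mapL (true ∷_) vs ++L mapL (false ∷_) vs))
    ≡⟨ cong length (filter-++ A? (mapL (true ∷_) vs) (mapL (false ∷_) vs)) ⟩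
  length (filter A? (mapL (true ∷_) vs) ++L filter A? (mapL (false ∷_) vs))
    ≡⟨ length-++ (filter A? (mapL (true ∷_) vs)) ⟩
  length (filter A? (mapL (true ∷_) vs)) + length (filter A? (mapL (false ∷_) vs))
    ≡⟨ cong₂ _+_ (trans (filter-map (true ∷_) vs) (size≡sumCube n (λ v → A (true ∷ v))))
                 (trans (filter-map (false ∷_) vs) (size≡sumCube n (λ v → A (false ∷ v)))) ⟩
  sumCube (suc n) (λ v → ind (A v)) ∎
  where
  open ≡-Reasoning
  vs = allVertices n
  A? = λ v → T? (A v)
  filter-map : (f : Vertex n → Vertex (suc n)) (L : List (Vertex n)) →
               length (filter A? (mapL f L)) ≡ length (filter (λ v → T? (A (f v))) L)
  filter-map f []L = refl
  filter-map f (v ∷L L) with A (f v)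
  ... | true  = cong suc (filter-map f L)
  ... | false = filter-map f L

sumCube-oneOfTwo : ∀ k p (S : VSet k) →
  sumCube k (λ y → ind (if not p then false else S y)) + sumCube k (λ y → ind (if p then false else S y)) ≡ size S
sumCube-oneOfTwo k true  S = trans (cong₂ _+_ (sym (size≡sumCube k S)) (sumCube-0 k)) (+-identityʳ _)
sumCube-oneOfTwo k false S = cong₂ _+_ (sumCube-0 k) (sym (size≡sumCube k S))

record Seed (k : ℕ) : Set where
  field
    threshold  : ℕ
    set        : VSet k
    percolates : Percolates k threshold set
open Seed

module Construction (n k : ℕ) (seed : ℕ → Seed k)
                    (enough : ∀ ℓ → suc n ≤ ℓ + threshold (seed ℓ)) where

  -- The fibre over b ∷ u carries seed(weight u) if b ∷ u has even parity, and nothing otherwise.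
  fibreSeeds : Vertex (suc n) → VSet k
  fibreSeeds (b ∷ u) y = if b xor parity u then false else set (seed (weight u)) y

  seedSet : VSet (suc n + k)
  seedSet v = fibreSeeds (take (suc n) v) (drop (suc n) v)

  seedSet-++ : ∀ x y → seedSet (x ++ y) ≡ fibreSeeds x y
  seedSet-++ x y = cong₂ fibreSeeds′ (++-injectiveˡ (take (suc n) (x ++ y)) x split)
                                   (++-injectiveʳ (take (suc n) (x ++ y)) x split)
    where
    split = take++drop≡id (suc n) (x ++ y)
    fibreSeeds′ : Vertex (suc n) → Vertex k → Bool
    fibreSeeds′ x′ y′ = fibreSeeds x′ y′

  open Bootstrap (suc n) seedSet
  open Fibres (suc n) {suc n} {k} seedSet

  EvenFibre OddFibre FibresInfected LowerInfected : Vertex n → Set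
  EvenFibre u = ∀ y → Eventually ((parity u ∷ u) ++ y)
  OddFibre  u = ∀ y → Eventually ((not (parity u) ∷ u) ++ y)
  FibresInfected u = EvenFibre u × OddFibre u
  LowerInfected u = ∀ i → lookup u i ≡ true → FibresInfected (flip i u)

  seeded : ∀ u y → set (seed (weight u)) y ≡ true → Eventually ((parity u ∷ u) ++ y)
  seeded u y p = 0 , trans (seedSet-++ (parity u ∷ u) y)
                           (trans (cong (λ b → if b then false else set (seed (weight u)) y) (xor-same (parity u))) p)

  -- The even fibre over u, of weight ℓ, is helped by the odd fibres over the ℓ lower neighbours.
  evenFibre : ∀ u → LowerInfected u → EvenFibre u
  evenFibre u low = fibreInfected (parity u ∷ u) (threshold S) (set S) (percolates S) (seeded u)
                      (lookup (false ∷ u)) lower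
                      (subst (λ w → suc n ≤ w + threshold S) (weight≡count u) (enough (weight u)))
    where
    S = seed (weight u)
    lower : ∀ i → lookup (false ∷ u) i ≡ true → ∀ y → Eventually (flip i (parity u ∷ u) ++ y)
    lower (suc i) p y = subst (λ b → Eventually ((b ∷ flip i u) ++ y))
                              (trans (cong not (parity-flip i u)) (not-involutive (parity u)))
                              (proj₂ (low i p) y)

  -- The odd fibre over u, of weight ℓ, is seeded by seed(ℓ + 1), where all 1 + n outside
  -- neighbours are infected (in the even fibre over u, the fibres over the lower neighbours and
  -- the seeds over the upper neighbours); it is then helped by the 1 + ℓ fully infected fibres.
  oddFibre : ∀ u → LowerInfected u → EvenFibre u → OddFibre u
  oddFibre u low even = fibreInfected x (threshold S) (set S) (percolates S) seeds
                          (lookup (true ∷ u)) evenOrLower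
                          (subst (λ w → suc n ≤ suc w + threshold S) (weight≡count u) (enough (suc (weight u))))
    where
    x = not (parity u) ∷ u
    S = seed (suc (weight u))

    evenOrLower : ∀ i → lookup (true ∷ u) i ≡ true → ∀ y → Eventually (flip i x ++ y)
    evenOrLower zero    _ y = subst (λ b → Eventually ((b ∷ u) ++ y)) (sym (not-involutive (parity u))) (even y)
    evenOrLower (suc i) p y = subst (λ b → Eventually ((b ∷ flip i u) ++ y)) (parity-flip i u) (proj₁ (low i p) y)

    outside : ∀ y → set S y ≡ true → ∀ i → Eventually (flip i x ++ y)
    outside y s zero = evenOrLower zero refl y
    outside y s (suc i) with lookup u i in q
    ... | true  = evenOrLower (suc i) q y
    ... | false = subst (λ b → Eventually ((b ∷ flip i u) ++ y)) (parity-flip i u)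
                        (seeded (flip i u) y (subst (λ w → set (seed w) y ≡ true) (sym (weight-flip-0 i u q)) s))

    seeds : ∀ y → set S y ≡ true → Eventually (x ++ y)
    seeds y s = byNeighbours x y (λ _ → true) (λ _ → false) (λ i _ → outside y s i) (λ _ ())
                  (≤-reflexive (sym (trans (cong₂ _+_ (count-true (suc n)) (count-false k)) (+-identityʳ _))))

  fibresInfected : ∀ ℓ u → weight u ≡ ℓ → FibresInfected u
  lowerInfected  : ∀ ℓ u → weight u ≡ ℓ → LowerInfected u

  fibresInfected ℓ u eq = even , oddFibre u low even
    where
    low  = lowerInfected ℓ u eq
    even = evenFibre u low

  lowerInfected zero    u eq i p with () ← trans (weight-flip-1 i u p) eq
  lowerInfected (suc ℓ) u eq i p = fibresInfected ℓ (flip i u) (suc-injective (trans (weight-flip-1 i u p) eq))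

  seedSet-percolates : Percolates (suc n + k) (suc n) seedSet
  seedSet-percolates v = subst Eventually (take++drop≡id (suc n) v) (inFibre (take (suc n) v) (drop (suc n) v))
    where
    inFibre : ∀ x y → Eventually (x ++ y)
    inFibre (b ∷ u) y with b ≟ᵇ parity u
    ... | yes b≡p = subst (λ c → Eventually ((c ∷ u) ++ y)) (sym b≡p) (proj₁ (fibresInfected _ u refl) y)
    ... | no  b≢p = subst (λ c → Eventually ((c ∷ u) ++ y)) (sym (¬-not b≢p)) (proj₂ (fibresInfected _ u refl) y)


  -- |seedSet| = Σ_{u ∈ Q_n} |seed(weight u)|, as exactly one of the two fibres over u is seeded.
  size-seedSet : size seedSet ≡ sumCube n (λ u → size (set (seed (weight u))))
  size-seedSet = begin
    size seedSet
      ≡⟨ size≡sumCube (suc n + k) seedSet ⟩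
    sumCube (suc n + k) (λ v → ind (seedSet v))
      ≡⟨ sumCube-++ (suc n) k (λ v → ind (seedSet v)) ⟩
    sumCube (suc n) (λ x → sumCube k (λ y → ind (seedSet (x ++ y))))
      ≡⟨ sumCube-cong (suc n) (λ x → sumCube-cong k (λ y → cong ind (seedSet-++ x y))) ⟩
    sumCube n (λ u → fibreSize (true ∷ u)) + sumCube n (λ u → fibreSize (false ∷ u))
      ≡⟨ sumCube-+ n (λ u → fibreSize (true ∷ u)) (λ u → fibreSize (false ∷ u)) ⟩
    sumCube n (λ u → fibreSize (true ∷ u) + fibreSize (false ∷ u))
      ≡⟨ sumCube-cong n (λ u → sumCube-oneOfTwo k (parity u) (set (seed (weight u)))) ⟩
    sumCube n (λ u → size (set (seed (weight u)))) ∎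
    where
    open ≡-Reasoning
    fibreSize : Vertex (suc n) → ℕ
    fibreSize x = sumCube k (λ y → ind (fibreSeeds x y))

sumBelow : ℕ → (ℕ → ℕ) → ℕ
sumBelow zero    f = 0
sumBelow (suc N) f = f 0 + sumBelow N (λ ℓ → f (suc ℓ))

sumBelow-cong : ∀ N {f g : ℕ → ℕ} → (∀ ℓ → f ℓ ≡ g ℓ) → sumBelow N f ≡ sumBelow N g
sumBelow-cong zero    h = refl
sumBelow-cong (suc N) h = cong₂ _+_ (h 0) (sumBelow-cong N (λ ℓ → h (suc ℓ)))

sumBelow-+ : ∀ N (f g : ℕ → ℕ) → sumBelow N f + sumBelow N g ≡ sumBelow N (λ ℓ → f ℓ + g ℓ)
sumBelow-+ zero    f g = refl
sumBelow-+ (suc N) f g = trans (interchange (f 0) (sumBelow N (λ ℓ → f (suc ℓ))) (g 0) (sumBelow N (λ ℓ → g (suc ℓ))))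
  (cong (f 0 + g 0 +_) (sumBelow-+ N (λ ℓ → f (suc ℓ)) (λ ℓ → g (suc ℓ))))

sumBelow-0 : ∀ N {f : ℕ → ℕ} → (∀ ℓ → f ℓ ≡ 0) → sumBelow N f ≡ 0
sumBelow-0 zero    h = refl
sumBelow-0 (suc N) h = cong₂ _+_ (h 0) (sumBelow-0 N (λ ℓ → h (suc ℓ)))

sumBelow-snoc : ∀ N f → sumBelow (suc N) f ≡ sumBelow N f + f N
sumBelow-snoc zero    f = +-comm (f 0) 0
sumBelow-snoc (suc N) f = trans (cong (f 0 +_) (sumBelow-snoc N (λ ℓ → f (suc ℓ))))
                                (sym (+-assoc (f 0) (sumBelow N (λ ℓ → f (suc ℓ))) (f (suc N))))

sumCube-weight : ∀ n N (G : ℕ → ℕ) → n < N → sumCube n (λ u → G (weight u)) ≡ sumBelow N (λ ℓ → (n C ℓ) * G ℓ)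
sumCube-weight zero (suc N) G _ =
  sym (trans (cong₂ _+_ (+-identityʳ (G 0)) (sumBelow-0 N (λ ℓ → cong (_* G (suc ℓ)) (k>n⇒nCk≡0 {0} {suc ℓ} (s≤s z≤n)))))
             (+-identityʳ (G 0)))
sumCube-weight (suc n) (suc N) G (s≤s n<N) = begin
  sumCube n (λ u → G (suc (weight u))) + sumCube n (λ u → G (weight u))
    ≡⟨ cong₂ _+_ (sumCube-weight n N (λ ℓ → G (suc ℓ)) n<N) (sumCube-weight n (suc N) G (m<n⇒m<1+n n<N)) ⟩
  sumBelow N (λ ℓ → (n C ℓ) * G (suc ℓ)) + (G 0 + 0 + sumBelow N (λ ℓ → (n C suc ℓ) * G (suc ℓ)))
    ≡⟨ x∙yz≈y∙xz (sumBelow N (λ ℓ → (n C ℓ) * G (suc ℓ))) (G 0 + 0) (sumBelow N (λ ℓ → (n C suc ℓ) * G (suc ℓ))) ⟩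
  G 0 + 0 + (sumBelow N (λ ℓ → (n C ℓ) * G (suc ℓ)) + sumBelow N (λ ℓ → (n C suc ℓ) * G (suc ℓ)))
    ≡⟨ cong (G 0 + 0 +_) (trans (sumBelow-+ N _ _) (sumBelow-cong N pascal)) ⟩
  sumBelow (suc N) (λ ℓ → (suc n C ℓ) * G ℓ) ∎
  where
  open ≡-Reasoning
  pascal : ∀ ℓ → (n C ℓ) * G (suc ℓ) + (n C suc ℓ) * G (suc ℓ) ≡ (suc n C suc ℓ) * G (suc ℓ)
  pascal ℓ = trans (sym (*-distribʳ-+ (G (suc ℓ)) (n C ℓ) (n C suc ℓ)))
                   (cong (_* G (suc ℓ)) (nCk+nC[k+1]≡[n+1]C[k+1] n ℓ))

sumBelow-pairs : ∀ J (h : ℕ → ℕ) →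
  sumBelow (suc (suc (2 * J))) h ≡ h 0 + h 1 + sumFrom1 J (λ j → h (2 * j) + h (suc (2 * j)))
sumBelow-pairs zero    h = sym (+-assoc (h 0) (h 1) 0)
sumBelow-pairs (suc J) h = begin
  sumBelow (suc (suc (2 * suc J))) h
    ≡⟨ cong (λ m → sumBelow (suc (suc m)) h) (*-suc 2 J) ⟩
  sumBelow (suc (suc m₂)) h
    ≡⟨ trans (sumBelow-snoc (suc m₂) h) (cong (_+ h (suc m₂)) (sumBelow-snoc m₂ h)) ⟩
  sumBelow m₂ h + h m₂ + h (suc m₂)
    ≡⟨ +-assoc (sumBelow m₂ h) (h m₂) (h (suc m₂)) ⟩
  sumBelow m₂ h + (h m₂ + h (suc m₂))
    ≡⟨ cong₂ _+_ (sumBelow-pairs J h) (cong (λ m → h m + h (suc m)) (sym (*-suc 2 J))) ⟩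
  h 0 + h 1 + sumFrom1 J (λ j → h (2 * j) + h (suc (2 * j))) + (h (2 * suc J) + h (suc (2 * suc J)))
    ≡⟨ +-assoc (h 0 + h 1) _ _ ⟩
  h 0 + h 1 + sumFrom1 (suc J) (λ j → h (2 * j) + h (suc (2 * j))) ∎
  where
  open ≡-Reasoning
  m₂ = suc (suc (2 * J))

sumFrom1-cong : ∀ J {f g : ℕ → ℕ} → (∀ j → 1 ≤ j → j ≤ J → f j ≡ g j) → sumFrom1 J f ≡ sumFrom1 J g
sumFrom1-cong zero    h = refl
sumFrom1-cong (suc J) h = cong₂ _+_ (sumFrom1-cong J (λ j p q → h j p (m≤n⇒m≤1+n q))) (h (suc J) (s≤s z≤n) ≤-refl)

double-half≤ : ∀ m → 2 * ⌊ m /2⌋ ≤ m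
double-half≤ zero          = z≤n
double-half≤ (suc zero)    = z≤n
double-half≤ (suc (suc m)) = subst (_≤ suc (suc m)) (sym (*-suc 2 ⌊ m /2⌋)) (s≤s (s≤s (double-half≤ m)))

≤suc-double-half : ∀ m → m ≤ suc (2 * ⌊ m /2⌋)
≤suc-double-half zero          = z≤n
≤suc-double-half (suc zero)    = s≤s z≤n
≤suc-double-half (suc (suc m)) = subst (suc (suc m) ≤_) (cong suc (sym (*-suc 2 ⌊ m /2⌋))) (s≤s (s≤s (≤suc-double-half m)))

half-double : ∀ j → ⌊ 2 * j /2⌋ ≡ j
half-double zero    = refl
half-double (suc j) = trans (cong ⌊_/2⌋ (*-suc 2 j)) (cong suc (half-double j))

half-suc-double : ∀ j → ⌊ suc (2 * j) /2⌋ ≡ j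
half-suc-double zero    = refl
half-suc-double (suc j) = trans (cong (λ m → ⌊ suc m /2⌋) (*-suc 2 j)) (cong suc (half-suc-double j))

optimal : ∀ {k t m} → IsM k t m → Seed k
optimal {t = t} h = record { threshold = t ; set = proj₁ (proj₁ h) ; percolates = proj₁ (proj₂ (proj₁ h)) }

size-optimal : ∀ {k t m} (h : IsM k t m) → size (set (optimal h)) ≡ m
size-optimal h = proj₂ (proj₂ (proj₁ h))

-- Under threshold 0 every vertex is infected after one step, so the empty set percolates.
emptySeed : ∀ {k} → Seed k
emptySeed = record { threshold = 0 ; set = λ _ → false ; percolates = λ v → 1 , refl }

module Choice (n k a b : ℕ) (c : ℕ → ℕ) (ha : IsM k (suc n) a) (hb : IsM k n b)
              (hc : ∀ j → 1 ≤ j → j ≤ ⌊ n /2⌋ → IsM k (suc n ∸ 2 * j) (c j)) where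

  -- Weights 2j and 2j + 1 (j = 1 + i) get an optimal set for threshold r - 2j while j ≤ ⌊n/2⌋;
  -- otherwise only weight 2j = r occurs and the empty set with threshold 0 suffices.
  pairSeed : ∀ i → Dec (suc i ≤ ⌊ n /2⌋) → Seed k
  pairSeed i (yes p) = optimal (hc (suc i) (s≤s z≤n) p)
  pairSeed i (no _)  = emptySeed

  seed : ℕ → Seed k
  seed 0             = optimal ha
  seed 1             = optimal hb
  seed (suc (suc ℓ)) = pairSeed ⌊ ℓ /2⌋ (suc ⌊ ℓ /2⌋ ≤? ⌊ n /2⌋)

  enough : ∀ ℓ → suc n ≤ ℓ + threshold (seed ℓ)
  enough 0             = ≤-refl
  enough 1             = ≤-refl
  enough (suc (suc ℓ)) = pairEnough (suc ⌊ ℓ /2⌋ ≤? ⌊ n /2⌋)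
    where
    twice : 2 * suc ⌊ ℓ /2⌋ ≤ suc (suc ℓ)
    twice = subst (_≤ suc (suc ℓ)) (sym (*-suc 2 ⌊ ℓ /2⌋)) (s≤s (s≤s (double-half≤ ℓ)))
    pairEnough : ∀ d → suc n ≤ suc (suc ℓ) + threshold (pairSeed ⌊ ℓ /2⌋ d)
    pairEnough (yes _) = ≤-trans (m≤n+m∸n (suc n) (2 * suc ⌊ ℓ /2⌋)) (+-monoˡ-≤ (suc n ∸ 2 * suc ⌊ ℓ /2⌋) twice)
    pairEnough (no p)  = begin
      suc n                          ≤⟨ s≤s (≤suc-double-half n) ⟩
      suc (suc (2 * ⌊ n /2⌋))        ≤⟨ s≤s (s≤s (*-monoʳ-≤ 2 (≤-pred (≰⇒> p)))) ⟩
      suc (suc (2 * ⌊ ℓ /2⌋))        ≤⟨ s≤s (s≤s (double-half≤ ℓ)) ⟩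
      suc (suc ℓ)                    ≡⟨ sym (+-identityʳ _) ⟩
      suc (suc ℓ) + 0                ∎
      where open ≤-Reasoning

  open Construction n k seed enough public using (seedSet; seedSet-percolates; size-seedSet)

  G : ℕ → ℕ
  G ℓ = size (set (seed ℓ))

  G-pair : ∀ ℓ i → ⌊ ℓ /2⌋ ≡ i → suc i ≤ ⌊ n /2⌋ → G (suc (suc ℓ)) ≡ c (suc i)
  G-pair ℓ _ refl le with suc ⌊ ℓ /2⌋ ≤? ⌊ n /2⌋
  ... | yes p = size-optimal (hc (suc ⌊ ℓ /2⌋) (s≤s z≤n) p)
  ... | no ¬p = contradiction le ¬p

  -- Pascal's rule merges the weights 2j and 2j + 1 into C(r, 2j+1) copies of an optimal set.
  pairTerm : ∀ j → 1 ≤ j → j ≤ ⌊ n /2⌋ →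
             (n C (2 * j)) * G (2 * j) + (n C suc (2 * j)) * G (suc (2 * j)) ≡ (suc n C (2 * j + 1)) * c j
  pairTerm (suc i) _ le = begin
    (n C (2 * suc i)) * G (2 * suc i) + (n C suc (2 * suc i)) * G (suc (2 * suc i))
      ≡⟨ cong (λ m → (n C m) * G m + (n C suc m) * G (suc m)) (*-suc 2 i) ⟩
    (n C m₂) * G m₂ + (n C suc m₂) * G (suc m₂)
      ≡⟨ cong₂ (λ x y → (n C m₂) * x + (n C suc m₂) * y) (G-pair (2 * i) i (half-double i) le)
                                                          (G-pair (suc (2 * i)) i (half-suc-double i) le) ⟩
    (n C m₂) * c (suc i) + (n C suc m₂) * c (suc i)
      ≡⟨ sym (*-distribʳ-+ (c (suc i)) (n C m₂) (n C suc m₂)) ⟩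
    (n C m₂ + n C suc m₂) * c (suc i)
      ≡⟨ cong (_* c (suc i)) (nCk+nC[k+1]≡[n+1]C[k+1] n m₂) ⟩
    (suc n C suc m₂) * c (suc i)
      ≡⟨ cong (λ m → (suc n C m) * c (suc i)) (sym (trans (+-comm (2 * suc i) 1) (cong suc (*-suc 2 i)))) ⟩
    (suc n C (2 * suc i + 1)) * c (suc i) ∎
    where
    open ≡-Reasoning
    m₂ = suc (suc (2 * i))

  size-seedSet≡bound : size seedSet ≡ a + n * b + sumFrom1 ⌊ n /2⌋ (λ j → (suc n C (2 * j + 1)) * c j)
  size-seedSet≡bound = begin
    size seedSet
      ≡⟨ size-seedSet ⟩
    sumCube n (λ u → G (weight u))
      ≡⟨ sumCube-weight n (suc (suc (2 * ⌊ n /2⌋))) G (s≤s (≤suc-double-half n)) ⟩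
    sumBelow (suc (suc (2 * ⌊ n /2⌋))) h
      ≡⟨ sumBelow-pairs ⌊ n /2⌋ h ⟩
    h 0 + h 1 + sumFrom1 ⌊ n /2⌋ (λ j → h (2 * j) + h (suc (2 * j)))
      ≡⟨ cong₂ _+_ (cong₂ _+_ (trans (+-identityʳ (G 0)) (size-optimal ha)) (cong₂ _*_ (nC1≡n n) (size-optimal hb)))
                   (sumFrom1-cong ⌊ n /2⌋ pairTerm) ⟩
    a + n * b + sumFrom1 ⌊ n /2⌋ (λ j → (suc n C (2 * j + 1)) * c j) ∎
    where
    open ≡-Reasoning
    h : ℕ → ℕ
    h ℓ = (n C ℓ) * G ℓ

lemma5p1 : (d r : ℕ) → 1 ≤ r → r ≤ d →
    (md a b : ℕ) → (c : ℕ → ℕ) →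
    IsM d r md →
    IsM (d ∸ r) r a →
    IsM (d ∸ r) (r ∸ 1) b →
    ((j : ℕ) → 1 ≤ j → j ≤ ⌈ r /2⌉ ∸ 1 → IsM (d ∸ r) (r ∸ 2 * j) (c j)) →
    md ≤ a + (r ∸ 1) * b + sumFrom1 (⌈ r /2⌉ ∸ 1) (λ j → (r C (2 * j + 1)) * c j)
lemma5p1 d (suc n) _ r≤d md a b c hmd ha hb hc =
  ≤-trans (proj₂ hmd′ seedSet seedSet-percolates) (≤-reflexive size-seedSet≡bound)
  where
  open Choice n (d ∸ suc n) a b c ha hb hc
  hmd′ : IsM (suc n + (d ∸ suc n)) (suc n) md
  hmd′ = subst (λ d′ → IsM d′ (suc n) md) (sym (m+[n∸m]≡n r≤d)) hmd
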